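{- Let $G=(V,E)$ be a connected proper chordal graph and $(T,r,\rho)$ an indifference tree-layout of $G$. If $x,y\in V$ and $y\in B(x)$, then $B(y)\subseteq B(x)$.
   Context: A tree-layout of $G=(V,E)$ is a triple $(T,r,\rho)$ with $T$ a tree on $|V|$ nodes rooted at $r$ and $\rho:V\to V(T)$ a bijection such that for every edge $xy$, $\rho(x)$ is an ancestor of $\rho(y)$ or vice versa. Write $u\prec v$ if $\rho(u)$ is a proper ancestor of $\rho(v)$; $A(v)=\{u:u\prec v\}$, $D(v)=\{u:v\prec u\}$. $G$ is proper chordal if it admits a tree-layout with no $x\prec y\prec z$ such that $xz\in E$ and exactly one of $xy,yz$ is in $E$. An indifference tree-layout is a tree-layout with no $x\prec y\prec z$ such that $xz\in E$ and ($xy\notin E$ or $yz\notin E$). For $S\subseteq V$, $N(S)$ is the set of vertices outside $S$ with a neighbour in $S$. For nonempty $S$ and a connected component $C$ of $G-S$, a vertex $v\in C$ is $S$-maximal if $N(w)\cap S\subseteq N(v)\cap S$ for every $w\in C$; $v$ is $U$-universal if $v$ is adjacent to every vertex of $U\setminus\{v\}$. The $S$-block of $C$ is the set of vertices of $C$ that are $S$-maximal and $(N(S)\cap C)$-universal. For $x\ne\rho^{ -1}(r)$, $B(x)$ is the $A(x)$-block of the component of $G-A(x)$ containing $x$; for the root vertex $x=\rho^{ -1}(r)$, $B(x)=\{x\}$. -}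

module Defs where

open import Data.Nat using (ℕ)
open import Data.Fin using (Fin)
open import Data.Maybe using (Maybe; just; nothing)
open import Data.Product using (Σ; ∃; _×_; _,_)
open import Data.Sum using (_⊎_)
open import Relation.Nullary using (¬_)
open import Relation.Binary using (Decidable)
open import Relation.Binary.PropositionalEquality using (_≡_; _≢_)
open import Function.Definitions using (Bijective)

record Graph (n : ℕ) : Set₁ where
  field
    _~_    : Fin n → Fin n → Set
    ~-dec  : Decidable _~_
    ~-sym  : ∀ {x y} → x ~ y → y ~ x
    ~-irr  : ∀ {x} → ¬ (x ~ x)

module GraphNotions {n : ℕ} (G : Graph n) where
  open Graph G

  data Reach (S : Fin n → Set) (x : Fin n) : Fin n → Set where
    here : ¬ S x → Reach S x x
    step : ∀ {u w} → Reach S x u → u ~ w → ¬ S w → Reach S x w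

  Empty : Fin n → Set
  Empty _ = Data.Empty.⊥ where import Data.Empty

  Connected : Set
  Connected = ∀ u v → Reach Empty u v

  Comp : (S : Fin n → Set) → Fin n → Fin n → Set
  Comp S x w = Reach S x w

  Nbh : (S : Fin n → Set) → Fin n → Set
  Nbh S w = ¬ S w × ∃ λ s → S s × w ~ s

  Maximal : (S C : Fin n → Set) → Fin n → Set
  Maximal S C v = ∀ w → C w → ∀ s → S s → w ~ s → v ~ s

  Universal : (U : Fin n → Set) → Fin n → Set
  Universal U v = ∀ u → U u → u ≢ v → v ~ u

  Block : (S : Fin n → Set) → (x : Fin n) → Fin n → Set
  Block S x v =
    Comp S x v × Maximal S (Comp S x) v
      × Universal (λ u → Nbh S u × Comp S x u) v

data AncOf {m : ℕ} (parent : Fin m → Maybe (Fin m)) (t : Fin m) : Fin m → Set where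
  anc-refl : AncOf parent t t
  anc-step : ∀ {s p} → parent s ≡ just p → AncOf parent t p → AncOf parent t s

record RootedTree (m : ℕ) : Set where
  field
    root   : Fin m
    parent : Fin m → Maybe (Fin m)
    root-noparent : parent root ≡ nothing
    nonroot-parent : ∀ t → parent t ≡ nothing → t ≡ root
    -- every node's parent chain reaches the root (acyclicity / tree)
    root-anc : ∀ t → AncOf parent root t

  Anc : Fin m → Fin m → Set
  Anc = AncOf parent

  ProperAnc : Fin m → Fin m → Set
  ProperAnc t s = Anc t s × t ≢ s

record TreeLayout {n : ℕ} (G : Graph n) : Set₁ where
  open Graph G
  field
    T    : RootedTree n
    ρ    : Fin n → Fin n
    ρ-bij : Bijective _≡_ _≡_ ρ
    edge-comparable : ∀ x y → x ~ y →
      RootedTree.Anc T (ρ x) (ρ y) ⊎ RootedTree.Anc T (ρ y) (ρ x)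
  open RootedTree T public

  _≺_ : Fin n → Fin n → Set
  u ≺ v = ProperAnc (ρ u) (ρ v)

  Anc-set : Fin n → Fin n → Set
  Anc-set v u = u ≺ v

  B : Fin n → Fin n → Set
  B x v = (ρ x ≡ root → v ≡ x)
        × (ρ x ≢ root → GraphNotions.Block G (Anc-set x) x v)

module _ {n : ℕ} {G : Graph n} where
  open Graph G

  IsProperChordalLayout : TreeLayout G → Set
  IsProperChordalLayout L = ∀ x y z → x ≺ y → y ≺ z → x ~ z →
      ¬ ((x ~ y × ¬ (y ~ z)) ⊎ (¬ (x ~ y) × y ~ z))
    where open TreeLayout L

  IsIndifferenceLayout : TreeLayout G → Set
  IsIndifferenceLayout L = ∀ x y z → x ≺ y → y ≺ z → x ~ z →
      ¬ (¬ (x ~ y) ⊎ ¬ (y ~ z))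
    where open TreeLayout L

ProperChordal : {n : ℕ} → Graph n → Set₁
ProperChordal G = Σ (TreeLayout G) IsProperChordalLayout

{-# OPTIONS --safe #-}
-- Hence the component of G − A(y) containing y sits inside
-- the component of G − A(x) containing x, and y's own maximality and universality in B(x)
-- transfer the two block conditions from B(y) to B(x).
module Submission where

open import Defs
open import Data.Nat using (ℕ)
open import Data.Fin using (Fin; _≟_)
open import Data.Maybe using (Maybe)
open import Data.Maybe.Properties using (just-injective)
open import Data.Product using (_×_; _,_; proj₁; proj₂)
open import Data.Sum using (_⊎_; inj₁; inj₂)
open import Relation.Nullary using (¬_; yes; no; contradiction)
open import Relation.Binary.PropositionalEquality using (_≡_; _≢_; refl; sym; trans; subst)

module _ {m : ℕ} {parent : Fin m → Maybe (Fin m)} where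

  anc-trans : ∀ {a b c} → AncOf parent a b → AncOf parent b c → AncOf parent a c
  anc-trans a≤b anc-refl         = a≤b
  anc-trans a≤b (anc-step p b≤p) = anc-step p (anc-trans a≤b b≤p)

  anc-comparable : ∀ {a b c} → AncOf parent a c → AncOf parent b c →
                   AncOf parent a b ⊎ AncOf parent b a
  anc-comparable anc-refl            b≤c      = inj₂ b≤c
  anc-comparable a≤c@(anc-step _ _) anc-refl = inj₁ a≤c
  anc-comparable (anc-step p a≤q) (anc-step p′ b≤q′)
    with just-injective (trans (sym p) p′)
  ... | refl = anc-comparable a≤q b≤q′

  anc-of-common-descendant : ∀ {a b c} → AncOf parent a c → AncOf parent b c →
                             ¬ (AncOf parent b a × b ≢ a) → AncOf parent a b
  anc-of-common-descendant {a} {b} a≤c b≤c b≮a with anc-comparable a≤c b≤c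
  ... | inj₁ a≤b = a≤b
  ... | inj₂ b≤a with b ≟ a
  ...   | yes refl = anc-refl
  ...   | no b≢a   = contradiction (b≤a , b≢a) b≮a

module _ {n : ℕ} (G : Graph n) where
  open Graph G
  open GraphNotions G

  reach-trans : ∀ {S a b c} → Reach S a b → Reach S b c → Reach S a c
  reach-trans a⇝b (here _)           = a⇝b
  reach-trans a⇝b (step b⇝u u~w w∉S) = step (reach-trans a⇝b b⇝u) u~w w∉S

  reach-antimono : ∀ {S S′ : Fin n → Set} → (∀ s → S s → S′ s) →
                   ∀ {a b} → Reach S′ a b → Reach S a b
  reach-antimono S⊆S′ (here a∉S′)        = here (λ a∈S → a∉S′ (S⊆S′ _ a∈S))
  reach-antimono S⊆S′ (step a⇝u u~w w∉S′) =
    step (reach-antimono S⊆S′ a⇝u) u~w (λ w∈S → w∉S′ (S⊆S′ _ w∈S))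

  reach-target-∉ : ∀ {S a b} → Reach S a b → ¬ S b
  reach-target-∉ (here a∉S)     = a∉S
  reach-target-∉ (step _ _ b∉S) = b∉S

module _ {n : ℕ} {G : Graph n} (L : TreeLayout G) where
  open Graph G
  open GraphNotions G
  open TreeLayout L

  ≺-irrefl : ∀ {x} → ¬ (x ≺ x)
  ≺-irrefl (_ , x≢x) = x≢x refl

  reach-below : ∀ {x w} → Reach (Anc-set x) x w → Anc (ρ x) (ρ w)
  reach-below (here _) = anc-refl
  reach-below (step {u} {w} x⇝u u~w w⊀x) with edge-comparable u w u~w
  ... | inj₁ u≤w = anc-trans (reach-below x⇝u) u≤w
  ... | inj₂ w≤u = anc-of-common-descendant (reach-below x⇝u) w≤u w⊀x

  reach-inherits-ancestors : ∀ {x y} → Reach (Anc-set x) x y → ∀ s → s ≺ x → s ≺ y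
  reach-inherits-ancestors {x} x⇝y s (s≤x , s≢x) =
    anc-trans s≤x (reach-below x⇝y) ,
    λ ρs≡ρy → reach-target-∉ G x⇝y (subst (λ t → ProperAnc t (ρ x)) ρs≡ρy (s≤x , s≢x))

  block-trans : ∀ {x y v} → Block (Anc-set x) x y → Block (Anc-set y) y v →
                Block (Anc-set x) x v
  block-trans {x} {y} {v} (x⇝y , max-y , univ-y) (y⇝v , max-v , univ-v) =
    reach-trans G x⇝y (reach-antimono G A[x]⊆A[y] y⇝v) , max , univ
    where
    A[x]⊆A[y] : ∀ s → s ≺ x → s ≺ y
    A[x]⊆A[y] = reach-inherits-ancestors x⇝y

    y⇝y : Reach (Anc-set y) y y
    y⇝y = here ≺-irrefl

    max : Maximal (Anc-set x) (Comp (Anc-set x) x) v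
    max w x⇝w s s≺x w~s = max-v y y⇝y s (A[x]⊆A[y] s s≺x) (max-y w x⇝w s s≺x w~s)

    univ : Universal (λ u → Nbh (Anc-set x) u × Comp (Anc-set x) x u) v
    univ u ((u∉A[x] , s , s≺x , u~s) , x⇝u) u≢v with ~-dec v u
    ... | yes v~u = v~u
    ... | no v≁u with u ≟ y
    ...   | yes refl =
      contradiction (univ-v u ((≺-irrefl , s , A[x]⊆A[y] s s≺x , u~s) , y⇝y) u≢v) v≁u
    ...   | no u≢y =
      contradiction (univ-v u ((u⊀y , s , A[x]⊆A[y] s s≺x , u~s) , step y⇝y y~u u⊀y) u≢v) v≁u
      where
      y~u : y ~ u
      y~u = univ-y u ((u∉A[x] , s , s≺x , u~s) , x⇝u) u≢y
      u⊀y : ¬ (u ≺ y)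
      u⊀y u≺y = v≁u (max-v y y⇝y u u≺y y~u)

  B-trans : ∀ {x y v} → B x y → B y v → B x v
  B-trans {x} {y} {v} B[x]y B[y]v@(y-root⇒v≡y , y-block) with ρ x ≟ root | ρ y ≟ root
  ... | yes x-root   | _            = subst (λ z → B z v) (proj₁ B[x]y x-root) B[y]v
  ... | no x-nonroot | yes y-root   = subst (B x) (sym (y-root⇒v≡y y-root)) B[x]y
  ... | no x-nonroot | no y-nonroot =
    (λ x-root → contradiction x-root x-nonroot) ,
    (λ _ → block-trans (proj₂ B[x]y x-nonroot) (y-block y-nonroot))

mainTheorem11 : {n : ℕ} (G : Graph n) → GraphNotions.Connected G → ProperChordal G →
    (L : TreeLayout G) → IsIndifferenceLayout L →
    (x y : Fin n) → TreeLayout.B L x y →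
    ∀ v → TreeLayout.B L y v → TreeLayout.B L x v
mainTheorem11 G _ _ L _ x y B[x]y v B[y]v = B-trans L B[x]y B[y]v
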